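{- Let $\mathbf{q}=(q_1,\dots,q_a)\in\prod_{j=1}^a L(v_1,x_j)$ and let $\mathcal{C}'_{\mathbf{q}}$ be the set of proper $L_X$-colorings $c$ of the graph $M_{\mathbf{q}}$ such that $c(v_1,x_j)=q_j$ for all $j\in[a]$. Then $\mathcal{C}'_{\mathbf{q}}\subseteq\mathcal{I}_{X,\mathbf{q}}$.
   Context: Standing setting: $n,a$ are integers with $2\le n\le a$; $M=K_n$ with $V(M)=\{v_1,\dots,v_n\}$; $K_{a,b}$ has partite sets $X=\{x_1,\dots,x_a\}$ and $Y=\{y_1,\dots,y_b\}$ with $b=\left(\prod_{i=0}^{n-1}(n+a-1-i)\right)^a-1$; $H=M\square K_{a,b}$ (Cartesian product). $L$ is an $(n+a-1)$-assignment for $H$ such that for each $i\in[n]$ the lists $L(v_i,x_1),\dots,L(v_i,x_a)$ are pairwise disjoint. $H_X$ is the subgraph of $H$ induced by $V_X=\{(v_i,x_j): i\in[n],j\in[a]\}$ (so $(v_i,x_j)\sim(v_{i'},x_{j'})$ in $H_X$ iff $j=j'$ and $i\ne i'$), $L_X$ is the restriction of $L$ to $V_X$, and $\mathcal{C}_X$ is the set of all proper $L_X$-colorings of $H_X$. A coloring is $(n-1)$-to-1 if each color in its range is used at most $n-1$ times. For each color $q\in\bigcup_{j=1}^a L(v_1,x_j)$, $s_q=1$ if there exists $c\in\mathcal{C}_X$ with $|c^{ -1}(q)|=n$, and $s_q=0$ otherwise. For $\mathbf{q}\in\prod_{j=1}^a L(v_1,x_j)$, $\mathcal{I}_{X,\mathbf{q}}$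 is the set of $(n-1)$-to-1 colorings $c\in\mathcal{C}_X$ with $c(v_1,x_j)=q_j$ for all $j\in[a]$. The graph $M_{\mathbf{q}}$ has vertex set $V_X$ and its edges are as follows: for each $j\in[a]$, if $s_{q_j}=0$ then $\{(v_i,x_j): i\in[n]\}$ is a clique; if $s_{q_j}=1$ then $(v_1,x_j)$ is adjacent to every vertex of $\{(v_2,x_{j'}): j'\in[a], j'\ne j\}$ and $\{(v_i,x_j): 2\le i\le n\}$ is a clique; there are no other edges. -}

module Defs where

open import Data.Nat using (ℕ; zero; suc; _+_; _*_; _∸_; _^_; _≤_; _≟_)
open import Data.Fin using (Fin; toℕ)
open import Data.Sum using (_⊎_; inj₁; inj₂)
open import Data.Product using (_×_; _,_; Σ-syntax)
open import Data.List using (List; length; filter; allFin; cartesianProduct)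
open import Data.List.Membership.Propositional using (_∈_)
open import Data.List.Relation.Unary.Unique.Propositional using (Unique)
open import Relation.Binary.PropositionalEquality using (_≡_; _≢_)
open import Data.Empty using (⊥)

fallProd : ℕ → ℕ → ℕ
fallProd m zero    = 1
fallProd m (suc k) = (m ∸ k) * fallProd m k

bSize : ℕ → ℕ → ℕ
bSize n a = (fallProd (n + a ∸ 1) n) ^ a ∸ 1

-- Vertices of H = K_n □ K_{a,b}: (v_i , x_j) is (i , inj₁ j), (v_i , y_k) is (i , inj₂ k).
-- Colours are natural numbers; a list is a duplicate-free List ℕ.
VertH : ℕ → ℕ → Set
VertH n a = Fin n × (Fin a ⊎ Fin (bSize n a))

Assignment : ℕ → ℕ → Set
Assignment n a = Fin n → Fin a ⊎ Fin (bSize n a) → List ℕ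

IsKAssignment : (n a k : ℕ) → Assignment n a → Set
IsKAssignment n a k L =
  ∀ (i : Fin n) (w : Fin a ⊎ Fin (bSize n a)) → Unique (L i w) × length (L i w) ≡ k

XListsDisjoint : (n a : ℕ) → Assignment n a → Set
XListsDisjoint n a L =
  ∀ (i : Fin n) (j j' : Fin a) → j ≢ j' → ∀ (r : ℕ) → r ∈ L i (inj₁ j) → r ∈ L i (inj₁ j') → ⊥

-- a colouring of V_X : c i j is the colour of (v_i , x_j)
ColX : ℕ → ℕ → Set
ColX n a = Fin n → Fin a → ℕ

IsLXColoring : (n a : ℕ) → Assignment n a → ColX n a → Set
IsLXColoring n a L c = ∀ (i : Fin n) (j : Fin a) → c i j ∈ L i (inj₁ j)

ProperHX : (n a : ℕ) → ColX n a → Set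
ProperHX n a c = ∀ (i i' : Fin n) (j : Fin a) → i ≢ i' → c i j ≢ c i' j

InCX : (n a : ℕ) → Assignment n a → ColX n a → Set
InCX n a L c = IsLXColoring n a L c × ProperHX n a c

preimageSize : (n a : ℕ) → ColX n a → ℕ → ℕ
preimageSize n a c q =
  length (filter (λ p → c (Data.Product.proj₁ p) (Data.Product.proj₂ p) ≟ q)
                 (cartesianProduct (allFin n) (allFin a)))

sIsOne : (n a : ℕ) → Assignment n a → ℕ → Set
sIsOne n a L q = Σ[ c ∈ ColX n a ] (InCX n a L c × preimageSize n a c q ≡ n)

IsToOne : (n a : ℕ) → ColX n a → Set
IsToOne n a c = ∀ (q : ℕ) → preimageSize n a c q ≤ n ∸ 1

-- c(v_1 , x_j) = q_j for all j   (v_1 is the vertex with index toℕ i ≡ 0)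
AgreesOnV1 : (n a : ℕ) → ColX n a → (Fin a → ℕ) → Set
AgreesOnV1 n a c q = ∀ (i : Fin n) (j : Fin a) → toℕ i ≡ 0 → c i j ≡ q j

InIXq : (n a : ℕ) → Assignment n a → (Fin a → ℕ) → ColX n a → Set
InIXq n a L q c = InCX n a L c × IsToOne n a c × AgreesOnV1 n a c q

-- edges of M_q (each undirected edge listed at least once; v_1 ↔ toℕ 0, v_2 ↔ toℕ 1)
data EdgeMq (n a : ℕ) (L : Assignment n a) (q : Fin a → ℕ) : Fin n × Fin a → Fin n × Fin a → Set where
  cliqueS0 : ∀ (j : Fin a) (i i' : Fin n) → (sIsOne n a L (q j) → ⊥) → i ≢ i' →
             EdgeMq n a L q (i , j) (i' , j)
  crossS1  : ∀ (j j' : Fin a) (i i' : Fin n) → sIsOne n a L (q j) → toℕ i ≡ 0 → toℕ i' ≡ 1 → j' ≢ j →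
             EdgeMq n a L q (i , j) (i' , j')
  cliqueS1 : ∀ (j : Fin a) (i i' : Fin n) → sIsOne n a L (q j) → toℕ i ≢ 0 → toℕ i' ≢ 0 → i ≢ i' →
             EdgeMq n a L q (i , j) (i' , j)

ProperMq : (n a : ℕ) → Assignment n a → (Fin a → ℕ) → ColX n a → Set
ProperMq n a L q c = ∀ (u w : Fin n × Fin a) → EdgeMq n a L q u w →
  c (Data.Product.proj₁ u) (Data.Product.proj₂ u) ≢ c (Data.Product.proj₁ w) (Data.Product.proj₂ w)

InCq' : (n a : ℕ) → Assignment n a → (Fin a → ℕ) → ColX n a → Set
InCq' n a L q c = IsLXColoring n a L c × ProperMq n a L q c × AgreesOnV1 n a c q

{-# OPTIONS --safe #-}
-- Since the lists L(v_i,x_1), …, L(v_i,x_a) are disjoint, an L_X-colouring uses each colour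
-- at most once in each row {(v_i,x_j) : j}, so a colour class has at most n elements, and one
-- of size n meets every row. Hence if s_r = 1, then r lies in at most one list of each column.
-- In c ∈ 𝒞'_q a colour repeated in column j therefore avoids (v_1,x_j) when s_{q_j} = 1, and
-- M_q makes the rest of the column a clique; so c ∈ 𝒞_X. A colour class of c of size n would
-- have s = 1 and colour q_j, where j is the column in which it meets row v_1; it meets row v_2
-- in some other column j', but M_q joins (v_1,x_j) to (v_2,x_j').
module Submission where

open import Defs
open import Data.Bool using (true; false)
open import Data.Empty using (⊥; ⊥-elim)
open import Data.Fin using (Fin; toℕ) renaming (zero to fzero; suc to fsuc)
import Data.Fin.Properties as Fin
open import Data.List using (List; []; _∷_; _++_; map; length; filter; allFin; cartesianProduct)
open import Data.List.Membership.Propositional using (_∈_; lose)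
open import Data.List.Membership.Propositional.Properties using (∈-allFin)
open import Data.List.Properties using (filter-++; filter-none; length-++; length-map; length-tabulate)
import Data.List.Relation.Unary.All as All
open import Data.List.Relation.Unary.All.Properties using (¬Any⇒All¬)
open import Data.List.Relation.Unary.AllPairs using ([]; _∷_)
open import Data.List.Relation.Unary.Any using (Any; any?; satisfied)
open import Data.List.Relation.Unary.Unique.Propositional using (Unique)
open import Data.List.Relation.Unary.Unique.Propositional.Properties using (allFin⁺)
open import Data.Nat using (ℕ; suc; _+_; _∸_; _≤_; _<_; z≤n; s≤s; _≟_; _≤?_)
open import Data.Nat.ListAction using (sum)
open import Data.Nat.Properties using (+-mono-≤; +-mono-<-≤; +-mono-≤-<; ≤-reflexive; ≤-antisym; <⇒≱; ≰⇒>)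
open import Data.Product using (_×_; _,_; proj₁; proj₂; ∃)
open import Data.Sum using (inj₁)
open import Function using (_∘_)
open import Relation.Binary.PropositionalEquality using (_≡_; _≢_; refl; sym; trans; cong; cong₂; subst; module ≡-Reasoning)
open import Relation.Nullary using (¬_; yes; no; does; contradiction)
open import Relation.Unary using (Decidable)

module _ {A B : Set} {P : B → Set} (P? : Decidable P) (f : A → B) where

  filter-map : ∀ xs → filter P? (map f xs) ≡ map f (filter (P? ∘ f) xs)
  filter-map []       = refl
  filter-map (x ∷ xs) with does (P? (f x))
  ... | true  = cong (f x ∷_) (filter-map xs)
  ... | false = filter-map xs

module _ {A : Set} {P : A → Set} (P? : Decidable P) where

  length-filter≤1 : ∀ {xs} → Unique xs → (∀ {x y} → P x → P y → x ≡ y) →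
                    length (filter P? xs) ≤ 1
  length-filter≤1 {[]}     []            _        = z≤n
  length-filter≤1 {x ∷ xs} (x∉xs ∷ !xs) P-unique with P? x
  ... | yes px = s≤s (≤-reflexive (cong length (filter-none P? ¬P-xs)))
    where
    ¬P-xs : All.All (¬_ ∘ P) xs
    ¬P-xs = All.map (λ x≢y py → x≢y (P-unique px py)) x∉xs
  ... | no  _  = length-filter≤1 !xs P-unique

  ¬Any⇒length-filter≡0 : ∀ {xs} → ¬ Any P xs → length (filter P? xs) ≡ 0
  ¬Any⇒length-filter≡0 {xs} ¬any = cong length (filter-none P? (¬Any⇒All¬ xs ¬any))

module _ {A : Set} (f : A → ℕ) (f≤1 : ∀ x → f x ≤ 1) where

  sum-map≤length : ∀ xs → sum (map f xs) ≤ length xs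
  sum-map≤length []       = z≤n
  sum-map≤length (x ∷ xs) = +-mono-≤ (f≤1 x) (sum-map≤length xs)

  sum-map<length : ∀ {xs} → Any (λ x → f x ≡ 0) xs → sum (map f xs) < length xs
  sum-map<length {x ∷ xs} (Any.here fx≡0) = +-mono-<-≤ (s≤s (≤-reflexive fx≡0)) (sum-map≤length xs)
  sum-map<length {x ∷ xs} (Any.there any) = +-mono-≤-< (f≤1 x) (sum-map<length any)

module _ {A B : Set} {P : A × B → Set} (P? : Decidable P) where

  rowCount : List B → A → ℕ
  rowCount ys x = length (filter (P? ∘ (x ,_)) ys)

  length-filter-cartesianProduct : ∀ xs ys →
    length (filter P? (cartesianProduct xs ys)) ≡ sum (map (rowCount ys) xs)
  length-filter-cartesianProduct []       ys = refl
  length-filter-cartesianProduct (x ∷ xs) ys = begin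
    length (filter P? (map (x ,_) ys ++ cartesianProduct xs ys))
      ≡⟨ cong length (filter-++ P? (map (x ,_) ys) _) ⟩
    length (filter P? (map (x ,_) ys) ++ filter P? (cartesianProduct xs ys))
      ≡⟨ length-++ (filter P? (map (x ,_) ys)) ⟩
    length (filter P? (map (x ,_) ys)) + length (filter P? (cartesianProduct xs ys))
      ≡⟨ cong₂ _+_ row (length-filter-cartesianProduct xs ys) ⟩
    rowCount ys x + sum (map (rowCount ys) xs) ∎
    where
    open ≡-Reasoning
    row : length (filter P? (map (x ,_) ys)) ≡ rowCount ys x
    row = trans (cong length (filter-map P? (x ,_) ys)) (length-map (x ,_) (filter (P? ∘ (x ,_)) ys))

  module _ (xs : List A) (ys : List B) (rowCount≤1 : ∀ x → rowCount ys x ≤ 1) where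

    length-filter-cartesianProduct≤length : length (filter P? (cartesianProduct xs ys)) ≤ length xs
    length-filter-cartesianProduct≤length =
      subst (_≤ length xs) (sym (length-filter-cartesianProduct xs ys))
            (sum-map≤length (rowCount ys) rowCount≤1 xs)

    length≤length-filter-cartesianProduct⇒rows-hit :
      length xs ≤ length (filter P? (cartesianProduct xs ys)) →
      ∀ {x} → x ∈ xs → Any (λ y → P (x , y)) ys
    length≤length-filter-cartesianProduct⇒rows-hit full {x} x∈xs with any? (P? ∘ (x ,_)) ys
    ... | yes hit = hit
    ... | no  miss = contradiction full (<⇒≱ count<length)
      where
      count<length : length (filter P? (cartesianProduct xs ys)) < length xs
      count<length = subst (_< length xs) (sym (length-filter-cartesianProduct xs ys))
        (sum-map<length (rowCount ys) rowCount≤1 (lose x∈xs (¬Any⇒length-filter≡0 _ miss)))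

module _ {n a : ℕ} {L : Assignment n a} (disjoint : XListsDisjoint n a L) where

  XListsDisjoint⇒column-unique : ∀ {i j j' r} → r ∈ L i (inj₁ j) → r ∈ L i (inj₁ j') → j ≡ j'
  XListsDisjoint⇒column-unique {i} {j} {j'} {r} r∈Lij r∈Lij' with j Fin.≟ j'
  ... | yes j≡j' = j≡j'
  ... | no  j≢j' = ⊥-elim (disjoint i j j' j≢j' r r∈Lij r∈Lij')

  module _ {c : ColX n a} (c∈L : IsLXColoring n a L c) where

    colour∈list : ∀ {i j r} → c i j ≡ r → r ∈ L i (inj₁ j)
    colour∈list {i} {j} cij≡r = subst (_∈ L i (inj₁ j)) cij≡r (c∈L i j)

    colour-in-row⇒colour-at : ∀ {i j k r} → c i k ≡ r → r ∈ L i (inj₁ j) → c i j ≡ r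
    colour-in-row⇒colour-at {i} {r = r} cik≡r r∈Lij =
      subst (λ k → c i k ≡ r) (XListsDisjoint⇒column-unique (colour∈list cik≡r) r∈Lij) cik≡r

    rowCount≤1 : ∀ r i → length (filter (λ j → c i j ≟ r) (allFin a)) ≤ 1
    rowCount≤1 r i = length-filter≤1 _ (allFin⁺ a) λ cij≡r cij'≡r →
      XListsDisjoint⇒column-unique (colour∈list cij≡r) (colour∈list cij'≡r)

    preimageSize≤n : ∀ r → preimageSize n a c r ≤ n
    preimageSize≤n r = subst (preimageSize n a c r ≤_) (length-tabulate {n = n} (λ i → i))
      (length-filter-cartesianProduct≤length (λ p → c (proj₁ p) (proj₂ p) ≟ r)
        (allFin n) (allFin a) (rowCount≤1 r))

    n≤preimageSize⇒rows-hit : ∀ {r} → n ≤ preimageSize n a c r → ∀ i → ∃ λ j → c i j ≡ r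
    n≤preimageSize⇒rows-hit {r} full i = satisfied
      (length≤length-filter-cartesianProduct⇒rows-hit (λ p → c (proj₁ p) (proj₂ p) ≟ r)
        (allFin n) (allFin a) (rowCount≤1 r) full′ (∈-allFin i))
      where
      full′ : length (allFin n) ≤ preimageSize n a c r
      full′ = subst (_≤ preimageSize n a c r) (sym (length-tabulate {n = n} (λ i → i))) full

  sIsOne⇒list-column-unique : ∀ {r i i' j} → sIsOne n a L r →
    r ∈ L i (inj₁ j) → r ∈ L i' (inj₁ j) → i ≡ i'
  sIsOne⇒list-column-unique {r} {i} {i'} {j} (c , (c∈L , c-proper) , size≡n) r∈Lij r∈Li'j
    with i Fin.≟ i'
  ... | yes i≡i' = i≡i'
  ... | no  i≢i' = ⊥-elim (c-proper i i' j i≢i'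
        (trans (colour-in-row⇒colour-at c∈L (proj₂ (hit i)) r∈Lij)
               (sym (colour-in-row⇒colour-at c∈L (proj₂ (hit i')) r∈Li'j))))
    where
    hit : ∀ i → ∃ λ j → c i j ≡ r
    hit = n≤preimageSize⇒rows-hit c∈L (≤-reflexive (sym size≡n))

  InCq'⇒ProperHX : ∀ {q c} → InCq' n a L q c → ProperHX n a c
  InCq'⇒ProperHX {q} {c} (c∈L , c-proper-Mq , c-agrees) i i' j i≢i' same =
    c-proper-Mq (i , j) (i' , j) (cliqueS0 j i i' ¬s i≢i') same
    where
    clash-at-v₁ : ∀ {u w} → u ≢ w → toℕ u ≡ 0 → c u j ≡ c w j → ¬ sIsOne n a L (q j)
    clash-at-v₁ {u} u≢w u=v₁ same s = u≢w (sIsOne⇒list-column-unique s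
      (colour∈list c∈L (c-agrees u j u=v₁))
      (colour∈list c∈L (trans (sym same) (c-agrees u j u=v₁))))
    -- s_{q_j} is not decidable: the edge for s_{q_j} = 0 is used with a refutation of
    -- s_{q_j} = 1, which is built from the other edges of column j.
    ¬s : ¬ sIsOne n a L (q j)
    ¬s s with toℕ i ≟ 0 | toℕ i' ≟ 0
    ... | yes i=v₁ | _          = clash-at-v₁ i≢i' i=v₁ same s
    ... | _        | yes i'=v₁  = clash-at-v₁ (i≢i' ∘ sym) i'=v₁ (sym same) s
    ... | no i≠v₁  | no i'≠v₁   = c-proper-Mq (i , j) (i' , j) (cliqueS1 j i i' s i≠v₁ i'≠v₁ i≢i') same

  InCX⇒full-colour-sIsOne : ∀ {c r} → InCX n a L c → n ≤ preimageSize n a c r → sIsOne n a L r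
  InCX⇒full-colour-sIsOne {c} {r} c∈CX full =
    c , c∈CX , ≤-antisym (preimageSize≤n (proj₁ c∈CX) r) full

InCq'⇒IsToOne : ∀ {n a L q c} → 2 ≤ n → XListsDisjoint n a L → InCq' n a L q c → IsToOne n a c
InCq'⇒IsToOne {n@(suc (suc m))} {a} {L} {q} {c} (s≤s (s≤s z≤n)) disjoint
              c∈Cq'@(c∈L , c-proper-Mq , c-agrees) r
  with preimageSize n a c r ≤? suc m
... | yes ≤n∸1 = ≤n∸1
... | no  ≰n∸1 = ⊥-elim (cross-clash (rows-hit fzero) (rows-hit (fsuc fzero)))
  where
  full : n ≤ preimageSize n a c r
  full = ≰⇒> ≰n∸1
  c-proper : ProperHX n a c
  c-proper = InCq'⇒ProperHX {L = L} disjoint c∈Cq'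
  rows-hit : ∀ i → ∃ λ j → c i j ≡ r
  rows-hit = n≤preimageSize⇒rows-hit {L = L} disjoint c∈L full
  cross-clash : (∃ λ j → c fzero j ≡ r) → (∃ λ j' → c (fsuc fzero) j' ≡ r) → ⊥
  cross-clash (j , c₁j≡r) (j' , c₂j'≡r) =
    c-proper-Mq (fzero , j) (fsuc fzero , j') (crossS1 j j' fzero (fsuc fzero) s refl refl j'≢j) same
    where
    same : c fzero j ≡ c (fsuc fzero) j'
    same = trans c₁j≡r (sym c₂j'≡r)
    s : sIsOne n a L (q j)
    s = subst (sIsOne n a L) (trans (sym c₁j≡r) (c-agrees fzero j refl))
          (InCX⇒full-colour-sIsOne {L = L} disjoint (c∈L , c-proper) full)
    j'≢j : j' ≢ j
    j'≢j refl = c-proper fzero (fsuc fzero) j (λ ()) same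

lemma19 : (n a : ℕ) → 2 ≤ n → n ≤ a →
    (L : Assignment n a) → IsKAssignment n a (n + a ∸ 1) L → XListsDisjoint n a L →
    (q : Fin a → ℕ) → (∀ (i : Fin n) (j : Fin a) → toℕ i ≡ 0 → q j ∈ L i (inj₁ j)) →
    (c : ColX n a) → InCq' n a L q c → InIXq n a L q c
lemma19 _ _ 2≤n _ L _ disjoint _ _ _ c∈Cq'@(c∈L , _ , c-agrees) =
  (c∈L , InCq'⇒ProperHX {L = L} disjoint c∈Cq') , InCq'⇒IsToOne {L = L} 2≤n disjoint c∈Cq' , c-agrees
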